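{- Let $n,k$ be integers with $n/2<k<n$. In the knights-and-spies searching problem in which spies are unconstrained, $\widetilde{T}_S(n,k)=n-1$ and $\overline{T}_S(n,k)=n$.
   Context: There are $n$ people, numbered $1,\dots,n$, each of whom is either a knight or a spy. It is known that at least $k$ of them are knights, where $n/2<k<n$. The only permitted questions have the form "Person $x$, is Person $y$ a spy?" with $x\neq y$, answered "yes" or "no" by Person $x$. Knights always answer truthfully; spies are unconstrained, i.e. each spy may answer each question truthfully or falsely as they see fit (adversarially). Questions are adaptive. A number of questions is "necessary and sufficient" for a task if some adaptive strategy accomplishes the task within that many questions for every consistent assignment of identities and every behaviour of the spies, and no strategy with fewer questions does. $\overline{T}_S(n,k)$ is the number of questions necessary and sufficient either to identify a spy or to correctly conclude that everyone is a knight. $\widetilde{T}_S(n,k)$ is the number of questions necessary and sufficient to identify a spy when it is known that at least one spy is present. -}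

module Defs where

open import Data.Nat using (ℕ; zero; suc; _≤_; _<_; _*_)
open import Data.Bool using (Bool; true; false; not; if_then_else_)
open import Data.Fin using (Fin)
open import Data.Fin.Subset using (Subset; ∣_∣; inside; outside; _∈_; _∉_)
open import Data.Vec using (lookup)
open import Data.Product using (Σ; _×_)
open import Data.Empty using (⊥)
open import Relation.Binary.PropositionalEquality using (_≡_; _≢_)
open import Relation.Nullary using (¬_)

-- An identity assignment is the subset K of knights (inside = knight,
-- outside = spy).

-- An adaptive questioning strategy is a decision tree.
--  ask x y f : ask "Person x, is Person y a spy?" (x ≢ y); the answer
--              (true = "yes") selects the subtree.
--  declareSpy z : stop and assert that z is a spy.
--  declareAllKnights : stop and assert that everyone is a knight.
data Strategy (n : ℕ) : Set where
  ask : (x y : Fin n) → x ≢ y → (Bool → Strategy n) → Strategy n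
  declareSpy : Fin n → Strategy n
  declareAllKnights : Strategy n

isKnight : ∀ {n} → Subset n → Fin n → Bool
isKnight K i = lookup K i

truth : ∀ {n} → Subset n → Fin n → Bool
truth K y = not (isKnight K y)

-- Succeeds K q s : for the true assignment K, strategy s terminates within
-- q questions with a correct conclusion, whatever the spies answer
-- (knights answer truthfully; a spy's answer may be either value, chosen
-- adaptively, so all branches must succeed).
Succeeds : ∀ {n} → Subset n → ℕ → Strategy n → Set
Succeeds K zero (ask x y _ f) = ⊥
Succeeds K (suc q) (ask x y _ f) =
  if isKnight K x
  then Succeeds K q (f (truth K y))
  else (Succeeds K q (f true) × Succeeds K q (f false))
Succeeds K q (declareSpy z) = z ∉ K
Succeeds K q declareAllKnights = ∀ i → i ∈ K

AtLeastKnights : ∀ {n} → ℕ → Subset n → Set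
AtLeastKnights k K = k ≤ ∣ K ∣

AtLeastKnightsSomeSpy : ∀ {n} → ℕ → Subset n → Set
AtLeastKnightsSomeSpy {n} k K = (k ≤ ∣ K ∣) × Σ (Fin n) (λ z → z ∉ K)

SolvableWithin : (n : ℕ) → (Subset n → Set) → ℕ → Set
SolvableWithin n Allowed q =
  Σ (Strategy n) (λ s → ∀ (K : Subset n) → Allowed K → Succeeds K q s)

NecSuff : (n : ℕ) → (Subset n → Set) → ℕ → Set
NecSuff n Allowed T =
  SolvableWithin n Allowed T × (∀ q → q < T → ¬ SolvableWithin n Allowed q)

-- \overline{T}_S(n,k) = T : identify a spy or conclude all are knights.
TbarS : ℕ → ℕ → ℕ → Set
TbarS n k T = NecSuff n (AtLeastKnights k) T

-- \widetilde{T}_S(n,k) = T : identify a spy, knowing one exists.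
TtildeS : ℕ → ℕ → ℕ → Set
TtildeS n k T = NecSuff n (AtLeastKnightsSomeSpy k) T

module Submission where

-- Lower bounds: follow a strategy along the branch on which every answer is "no". If v is never
-- asked about there, the branch is consistent with v being the only spy, so the strategy must end
-- by accusing v; it is also consistent with everyone being a knight. With at most n − 2 questions
-- two people are missed and both would have to be accused; with at most n − 1 questions some v is
-- missed and the same outcome would have to clear everyone and accuse v.
--
-- Upper bounds: knights are a strict majority. Person 0 is kept in reserve and the others are
-- pushed onto a chain whose top is asked about each newcomer: "no" pushes the newcomer (a knight
-- top vouches for it), "yes" discards both, a pair containing a spy, which keeps knights a strict
-- majority of the remaining pool. So in the end the top of the chain (or the reserve, if the chain
-- is empty) is a knight. Asked about a member of the last discarded pair, it exposes a spy; if
-- nothing was discarded, asking it about the bottom of the chain exposes a spy or clears the whole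
-- chain, leaving only the reserve. This costs n − 2 questions plus one or two.

open import Defs
open import Data.Nat using (ℕ; _<_; _*_; _∸_)
open import Data.Product using (_×_)

open import Data.Nat using (zero; suc; _+_; _≤_; z≤n; s≤s; _<?_)
open import Data.Nat.Properties
  using ( ≤-pred; m+n≤o⇒n≤o; +-comm; +-identityʳ; +-suc; +-monoˡ-≤; *-monoʳ-≤
        ; ≤-trans; ≤-<-trans; m∸n≤m; ≮⇒≥; <⇒≱; module ≤-Reasoning)
open import Data.Nat.ListAction using (sum)
open import Data.Nat.ListAction.Properties using (sum-↭)
open import Data.Bool using (Bool; true; false; not; if_then_else_; T)
open import Data.Fin using (Fin; zero; suc; _≟_)
open import Data.Fin.Properties using (pigeonhole; ¬∀⟶∃¬) renaming (<⇒≢ to <⇒≢ᶠ)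
open import Data.Fin.Subset using (Subset; ∣_∣; ⊤; ∁; ⁅_⁆; _∈_; _∉_)
open import Data.Fin.Subset.Properties
  using ( ∣⊤∣≡n; ∣∁p∣≡n∸∣p∣; ∣⁅x⁆∣≡1; x∈⁅x⁆; x∈⁅y⁆⇒x≡y; x≢y⇒x∉⁅y⁆
        ; x∈p⇒x∉∁p; x∉p⇒x∈∁p; x∉∁p⇒x∈p)
open import Data.Vec using ([]; _∷_)
open import Data.Vec.Properties using ([]=⇒lookup; lookup⇒[]=; lookup-replicate)
open import Data.List using (List; []; _∷_; _++_; map; length; tabulate; allFin)
open import Data.List.Properties using (++-identityʳ; length-tabulate; map-tabulate)
open import Data.List.Relation.Unary.All as All using (All; []; _∷_)
open import Data.List.Relation.Unary.Any using (index; any?; here; there)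
open import Data.List.Relation.Unary.Any.Properties using (lookup-index)
open import Data.List.Relation.Unary.Linked using (Linked; []; [-]; _∷_)
import Data.List.Relation.Unary.Linked as Linked
import Data.List.Membership.Propositional as List
open import Data.List.Membership.Propositional.Properties using (∈-allFin)
open import Data.List.Relation.Binary.Permutation.Propositional using (_↭_; ↭-prep; ↭-trans; ↭-sym)
open import Data.List.Relation.Binary.Permutation.Propositional.Properties using (shift; ∈-resp-↭; map⁺)
open import Data.Product using (∃; _,_; proj₁; proj₂)
open import Data.Sum using (_⊎_; inj₁; inj₂)
open import Data.Empty using (⊥-elim)
open import Function using (_∘_)
open import Relation.Nullary using (¬_; yes; no; contradiction)
open import Relation.Binary.PropositionalEquality

Knight Spy : ∀ {n} → Subset n → Fin n → Set
Knight K x = isKnight K x ≡ true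
Spy K x = isKnight K x ≡ false

knight⇒∈ : ∀ {n} {K : Subset n} {x} → Knight K x → x ∈ K
knight⇒∈ {K = K} {x} = lookup⇒[]= x K

∈⇒knight : ∀ {n} {K : Subset n} {x} → x ∈ K → Knight K x
∈⇒knight = []=⇒lookup

spy⇒∉ : ∀ {n} {K : Subset n} {x} → Spy K x → x ∉ K
spy⇒∉ spy x∈K with () ← trans (sym spy) (∈⇒knight x∈K)

module _ {n} (K : Subset n) where

  succeeds-suc : ∀ {q} s → Succeeds K q s → Succeeds K (suc q) s
  succeeds-suc {zero}  (ask x y _ f) ()
  succeeds-suc {suc q} (ask x y _ f) h with isKnight K x
  ... | true  = succeeds-suc (f _) h
  ... | false = succeeds-suc (f true) (proj₁ h) , succeeds-suc (f false) (proj₂ h)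
  succeeds-suc {zero}  (declareSpy z)    h = h
  succeeds-suc {suc q} (declareSpy z)    h = h
  succeeds-suc {zero}  declareAllKnights h = h
  succeeds-suc {suc q} declareAllKnights h = h

  declareSpy-succeeds : ∀ q {z} → z ∉ K → Succeeds K q (declareSpy z)
  declareSpy-succeeds zero    h = h
  declareSpy-succeeds (suc q) h = h

  declareAllKnights-succeeds : ∀ q → (∀ i → i ∈ K) → Succeeds K q declareAllKnights
  declareAllKnights-succeeds zero    h = h
  declareAllKnights-succeeds (suc q) h = h

-- Nobody may be asked about themself; a knight would answer "no", so that answer is assumed.
ask? : ∀ {n} → Fin n → Fin n → (Bool → Strategy n) → Strategy n
ask? x y f with x ≟ y
... | yes _   = f false
... | no x≢y = ask x y x≢y f

ask?-succeeds : ∀ {n} (K : Subset n) {q} x y (f : Bool → Strategy n) →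
  ((Knight K x → Spy K y) → Succeeds K q (f true)) →
  ((Knight K x → Knight K y) → Succeeds K q (f false)) →
  Succeeds K (suc q) (ask? x y f)
ask?-succeeds K x y f onYes onNo with x ≟ y
... | yes refl = succeeds-suc K (f false) (onNo λ kx → kx)
... | no _ with isKnight K x | isKnight K y
...   | true  | true  = onNo λ _ → refl
...   | true  | false = onYes λ _ → refl
...   | false | _     = onYes (λ ()) , onNo (λ ())

-- Lower bounds

silentTargets : ∀ {n} → ℕ → Strategy n → List (Fin n)
silentTargets zero    s                 = []
silentTargets (suc q) (ask x y _ f)     = y ∷ silentTargets q (f false)
silentTargets (suc q) (declareSpy _)    = []
silentTargets (suc q) declareAllKnights = []

silentOutcome : ∀ {n} → ℕ → Strategy n → Strategy n
silentOutcome zero    s                 = s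
silentOutcome (suc q) (ask x y _ f)     = silentOutcome q (f false)
silentOutcome (suc q) (declareSpy z)    = declareSpy z
silentOutcome (suc q) declareAllKnights = declareAllKnights

length-silentTargets : ∀ {n} q (s : Strategy n) → length (silentTargets q s) ≤ q
length-silentTargets zero    s                 = z≤n
length-silentTargets (suc q) (ask x y _ f)     = s≤s (length-silentTargets q (f false))
length-silentTargets (suc q) (declareSpy _)    = z≤n
length-silentTargets (suc q) declareAllKnights = z≤n

succeeds-silentOutcome : ∀ {n} (K : Subset n) q s → All (Knight K) (silentTargets q s) →
  Succeeds K q s → Succeeds K 0 (silentOutcome q s)
succeeds-silentOutcome K zero    s                 _          h = h
succeeds-silentOutcome K (suc q) (ask x y _ f)     (ky ∷ kys) h with isKnight K x
... | true rewrite ky = succeeds-silentOutcome K q (f false) kys h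
... | false           = succeeds-silentOutcome K q (f false) kys (proj₂ h)
succeeds-silentOutcome K (suc q) (declareSpy z)    _          h = h
succeeds-silentOutcome K (suc q) declareAllKnights _          h = h

-- If everyone occurred in xs, first occurrences would inject Fin n into Fin (length xs).
∃∉ : ∀ {n} (xs : List (Fin n)) → length xs < n → ∃ λ v → ¬ v List.∈ xs
∃∉ {n} xs |xs|<n = ¬∀⟶∃¬ n (List._∈ xs) (λ v → any? (v ≟_) xs) ¬covered
  where
  ¬covered : ¬ (∀ v → v List.∈ xs)
  ¬covered v∈xs with i , j , i<j , same ← pigeonhole |xs|<n (index ∘ v∈xs) =
    <⇒≢ᶠ i<j (trans (lookup-index (v∈xs i))
                   (trans (cong (Data.List.lookup xs) same) (sym (lookup-index (v∈xs j)))))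

loneSpy-knights : ∀ {n} v (xs : List (Fin n)) → ¬ v List.∈ xs → All (Knight (∁ ⁅ v ⁆)) xs
loneSpy-knights v xs v∉xs = All.tabulate λ { {y} y∈xs →
  ∈⇒knight (x∉p⇒x∈∁p (x≢y⇒x∉⁅y⁆ {x = y} {y = v} λ { refl → v∉xs y∈xs })) }

loneSpy-spy : ∀ {n} (v : Fin n) → v ∉ ∁ ⁅ v ⁆
loneSpy-spy v = x∈p⇒x∉∁p (x∈⁅x⁆ v)

loneSpy-allowed : ∀ {n k} (v : Fin n) → k ≤ n ∸ 1 → AtLeastKnightsSomeSpy k (∁ ⁅ v ⁆)
loneSpy-allowed {n} v k≤n∸1 = subst (_ ≤_) (sym |∁⁅v⁆|≡n∸1) k≤n∸1 , v , loneSpy-spy v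
  where
  |∁⁅v⁆|≡n∸1 : ∣ ∁ ⁅ v ⁆ ∣ ≡ n ∸ 1
  |∁⁅v⁆|≡n∸1 = trans (∣∁p∣≡n∸∣p∣ ⁅ v ⁆) (cong (n ∸_) (∣⁅x⁆∣≡1 v))

loneSpy-accused : ∀ {n} q (s : Strategy n) v → ¬ v List.∈ silentTargets q s →
  Succeeds (∁ ⁅ v ⁆) q s → silentOutcome q s ≡ declareSpy v
loneSpy-accused q s v v∉ h
  with silentOutcome q s | succeeds-silentOutcome (∁ ⁅ v ⁆) q s (loneSpy-knights v _ v∉) h
... | declareSpy z      | z∉ = cong declareSpy (x∈⁅y⁆⇒x≡y v (x∉∁p⇒x∈p z∉))
... | declareAllKnights | all = ⊥-elim (loneSpy-spy v (all v))

noSpy-cleared : ∀ {n} q (s : Strategy n) → Succeeds ⊤ q s → silentOutcome q s ≡ declareAllKnights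
noSpy-cleared {n} q s h
  with silentOutcome q s
     | succeeds-silentOutcome ⊤ q s (All.tabulate λ {y} _ → lookup-replicate y true) h
... | declareSpy z      | z∉ = ⊥-elim (z∉ (knight⇒∈ (lookup-replicate z true)))
... | declareAllKnights | _  = refl

identifySpy-lowerBound : ∀ {n k q} → k ≤ n ∸ 1 → suc q < n →
  ¬ SolvableWithin n (AtLeastKnightsSomeSpy k) q
identifySpy-lowerBound {q = q} k≤n∸1 q+1<n (s , solves) =
  let v , v∉ = ∃∉ (silentTargets q s) (≤-<-trans (length-silentTargets q s) (m+n≤o⇒n≤o 1 q+1<n))
      w , w∉ = ∃∉ (v ∷ silentTargets q s) (≤-<-trans (s≤s (length-silentTargets q s)) q+1<n)
  in  w∉ (here (declareSpy-injective (trans (sym (accused w (w∉ ∘ there))) (accused v v∉))))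
  where
  accused : ∀ u → ¬ u List.∈ silentTargets q s → silentOutcome q s ≡ declareSpy u
  accused u u∉ = loneSpy-accused q s u u∉ (solves _ (loneSpy-allowed u k≤n∸1))
  declareSpy-injective : ∀ {u w} → declareSpy w ≡ declareSpy u → w ≡ u
  declareSpy-injective refl = refl

identifySpyOrClear-lowerBound : ∀ {n k q} → k ≤ n ∸ 1 → q < n →
  ¬ SolvableWithin n (AtLeastKnights k) q
identifySpyOrClear-lowerBound {n} {k} {q} k≤n∸1 q<n (s , solves) =
  let v , v∉ = ∃∉ (silentTargets q s) (≤-<-trans (length-silentTargets q s) q<n)
  in  cleared≢accused (trans (sym (noSpy-cleared q s (solves ⊤ ⊤-allowed)))
                             (loneSpy-accused q s v v∉ (solves _ (proj₁ (loneSpy-allowed v k≤n∸1)))))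
  where
  ⊤-allowed : AtLeastKnights k (⊤ {n})
  ⊤-allowed = subst (_ ≤_) (sym (∣⊤∣≡n n)) (≤-trans k≤n∸1 (m∸n≤m n 1))
  cleared≢accused : ∀ {v} → declareAllKnights ≢ declareSpy v
  cleared≢accused ()

-- Majorities

indicator : Bool → ℕ
indicator b = if b then 1 else 0

#knights #spies : ∀ {n} → Subset n → List (Fin n) → ℕ
#knights K xs = sum (map (indicator ∘ isKnight K) xs)
#spies   K xs = sum (map (indicator ∘ truth K) xs)

Majority : ∀ {n} → Subset n → List (Fin n) → Set
Majority K xs = #spies K xs < #knights K xs

majority-↭ : ∀ {n} (K : Subset n) {xs ys} → xs ↭ ys → Majority K xs → Majority K ys
majority-↭ K xs↭ys = subst₂ _<_ (sum-↭ (map⁺ (indicator ∘ truth K) xs↭ys))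
                                (sum-↭ (map⁺ (indicator ∘ isKnight K) xs↭ys))

majority-dropPair : ∀ {n} (K : Subset n) {x y xs} → Spy K x ⊎ Spy K y →
  Majority K (x ∷ y ∷ xs) → Majority K xs
majority-dropPair K {x} {y} = drop (isKnight K x) (isKnight K y)
  where
  drop : ∀ a b {s k} → a ≡ false ⊎ b ≡ false →
    indicator (not a) + (indicator (not b) + s) < indicator a + (indicator b + k) → s < k
  drop true  true  (inj₁ ())
  drop true  true  (inj₂ ())
  drop true  false _ h = ≤-pred h
  drop false true  _ h = ≤-pred h
  drop false false _ h = m+n≤o⇒n≤o 2 h

#knights-allSpies : ∀ {n} (K : Subset n) {xs} → All (Spy K) xs → #knights K xs ≡ 0
#knights-allSpies K []                = refl
#knights-allSpies K (spy ∷ spies) rewrite spy = #knights-allSpies K spies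

¬majority-allSpies : ∀ {n} (K : Subset n) r {t cs} → All (Spy K) (t ∷ cs) →
  ¬ Majority K (r ∷ t ∷ cs)
¬majority-allSpies K r (spy ∷ spies) rewrite spy = lone (isKnight K r) (#knights-allSpies K spies)
  where
  lone : ∀ a {s k} → k ≡ 0 → ¬ indicator (not a) + suc s < indicator a + k
  lone true  refl (s≤s ())
  lone false refl ()

#spies+#knights≡length : ∀ {n} (K : Subset n) xs → #spies K xs + #knights K xs ≡ length xs
#spies+#knights≡length K [] = refl
#spies+#knights≡length K (x ∷ xs) with isKnight K x
... | true  = trans (+-suc _ _) (cong suc (#spies+#knights≡length K xs))
... | false = cong suc (#spies+#knights≡length K xs)

#knights-shift : ∀ {n} b (K : Subset n) →
  #knights (b ∷ K) (tabulate {n = n} suc) ≡ #knights K (allFin n)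
#knights-shift b K = cong sum (trans (map-tabulate suc (indicator ∘ isKnight (b ∷ K)))
                                     (sym (map-tabulate (λ i → i) (indicator ∘ isKnight K))))

#knights-allFin : ∀ {n} (K : Subset n) → #knights K (allFin n) ≡ ∣ K ∣
#knights-allFin []          = refl
#knights-allFin (true ∷ K)  = cong suc (trans (#knights-shift true K) (#knights-allFin K))
#knights-allFin (false ∷ K) = trans (#knights-shift false K) (#knights-allFin K)

strictMajority : ∀ {s c n k} → s + c ≡ n → k ≤ c → n < 2 * k → s < c
strictMajority {s} {c} {n} {k} s+c≡n k≤c n<2k with s <? c
... | yes s<c = s<c
... | no  s≮c = contradiction 2k≤n (<⇒≱ n<2k)
  where
  open ≤-Reasoning
  2k≤n : 2 * k ≤ n
  2k≤n = begin
    2 * k  ≤⟨ *-monoʳ-≤ 2 k≤c ⟩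
    2 * c  ≡⟨ cong (c +_) (+-identityʳ c) ⟩
    c + c  ≤⟨ +-monoˡ-≤ c (≮⇒≥ s≮c) ⟩
    s + c  ≡⟨ s+c≡n ⟩
    n      ∎

majority-allFin : ∀ {n k} (K : Subset n) → n < 2 * k → k ≤ ∣ K ∣ → Majority K (allFin n)
majority-allFin {n} K n<2k k≤∣K∣ = strictMajority
  (trans (#spies+#knights≡length K (allFin n)) (length-tabulate (λ i → i)))
  (subst (_ ≤_) (sym (#knights-allFin K)) k≤∣K∣)
  n<2k

-- The chain protocol

-- spyAmong x y: the last discarded pair, which contains a spy.
data Evidence (n : ℕ) : Set where
  noneDiscarded : Evidence n
  spyAmong      : Fin n → Fin n → Evidence n

bottom : ∀ {n} → Fin n → List (Fin n) → Fin n
bottom t []       = t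
bottom t (c ∷ cs) = bottom c cs

judge : ∀ {n} → Fin n → List (Fin n) → Fin n
judge r []      = r
judge r (t ∷ _) = t

reserveCost finishCost : Bool → ℕ
reserveCost true  = 0
reserveCost false = 1
finishCost b = suc (reserveCost b)

-- The flag says whether a spy is promised; if so, the reserve r is the spy once everyone else is cleared.
clearReserve : ∀ {n} → Bool → Fin n → Fin n → Strategy n
clearReserve true  t r = declareSpy r
clearReserve false t r = ask? t r λ yes → if yes then declareSpy r else declareAllKnights

finish : ∀ {n} → Bool → Fin n → Evidence n → List (Fin n) → Strategy n
finish b r (spyAmong x y) ch       = ask? (judge r ch) x λ yes → declareSpy (if yes then x else y)
finish b r noneDiscarded  []       = declareAllKnights
finish b r noneDiscarded  (t ∷ cs) =
  ask? t (bottom t cs) λ yes → if yes then declareSpy (bottom t cs) else clearReserve b t r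

-- The chain ch is listed top first, and each member vouched for the one above it;
-- p is the queue of people not yet examined, and r is kept in reserve.
sweep : ∀ {n} → Bool → Fin n → Evidence n → List (Fin n) → List (Fin n) → Strategy n
sweep b r e ch       []      = finish b r e ch
sweep b r e []       (y ∷ p) = sweep b r e (y ∷ []) p
sweep b r e (t ∷ cs) (y ∷ p) =
  ask? t y λ yes → if yes then sweep b r (spyAmong t y) cs p else sweep b r e (y ∷ t ∷ cs) p

chainProtocol : Bool → ∀ m → Strategy (suc (suc m))
chainProtocol b m = sweep b zero noneDiscarded (suc zero ∷ []) (tabulate λ i → suc (suc i))

VouchedBy : ∀ {n} → Subset n → Fin n → Fin n → Set
VouchedBy K a b = Knight K b → Knight K a

Sound : ∀ {n} → Subset n → Evidence n → List (Fin n) → Set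
Sound K noneDiscarded  pool = ∀ i → i List.∈ pool
Sound K (spyAmong x y) pool = Spy K x ⊎ Spy K y

record Invariant {n} (K : Subset n) (r : Fin n) (e : Evidence n) (ch p : List (Fin n)) : Set where
  field
    linked   : Linked (VouchedBy K) ch
    majority : Majority K (r ∷ ch ++ p)
    sound    : Sound K e (r ∷ ch ++ p)
open Invariant

module _ {n} (K : Subset n) where

  linked-topSpy : ∀ {t cs} → Linked (VouchedBy K) (t ∷ cs) → Spy K t → All (Spy K) (t ∷ cs)
  linked-topSpy [-]              spy = spy ∷ []
  linked-topSpy (vouched ∷ rest) spy = spy ∷ linked-topSpy rest (contraposition vouched spy)
    where
    contraposition : ∀ {a c} → VouchedBy K a c → Spy K a → Spy K c
    contraposition {c = c} vouched spy with isKnight K c in kc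
    ... | true  with () ← trans (sym spy) (vouched refl)
    ... | false = refl

  linked-bottomKnight : ∀ {t cs} → Linked (VouchedBy K) (t ∷ cs) → Knight K (bottom t cs) →
    All (Knight K) (t ∷ cs)
  linked-bottomKnight [-]              knight = knight ∷ []
  linked-bottomKnight (vouched ∷ rest) knight with linked-bottomKnight rest knight
  ... | knights@(next ∷ _) = vouched next ∷ knights

  covered-allKnights : ∀ {xs} → (∀ i → i List.∈ xs) → All (Knight K) xs → ∀ i → i ∈ K
  covered-allKnights covered knights i = knight⇒∈ (All.lookup knights (covered i))

  otherSpy : ∀ {x y} → Spy K x ⊎ Spy K y → Knight K x → Spy K y
  otherSpy (inj₁ spy) knight with () ← trans (sym spy) knight
  otherSpy (inj₂ spy) _      = spy

  oneSpy : ∀ {t y} → (Knight K t → Spy K y) → Spy K t ⊎ Spy K y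
  oneSpy {t} t⇒spy with isKnight K t
  ... | true  = inj₂ (t⇒spy refl)
  ... | false = inj₁ refl

  module _ {r : Fin n} where

    judge-knight : ∀ {e ch} → Invariant K r e ch [] → Knight K (judge r ch)
    judge-knight {ch = []} inv = lone (isKnight K r) (majority inv)
      where
      lone : ∀ a → indicator (not a) + 0 < indicator a + 0 → a ≡ true
      lone true  _ = refl
      lone false ()
    judge-knight {ch = t ∷ cs} inv with isKnight K t in kt
    ... | true  = refl
    ... | false = ⊥-elim (¬majority-allSpies K r (linked-topSpy (linked inv) kt)
                           (subst (λ l → Majority K (r ∷ t ∷ l)) (++-identityʳ cs) (majority inv)))

    invariant-push : ∀ {e t cs y p} → Invariant K r e (t ∷ cs) (y ∷ p) → VouchedBy K y t →
      Invariant K r e (y ∷ t ∷ cs) p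
    invariant-push {e} {t} {cs} {y} {p} inv vouched = record
      { linked   = vouched ∷ linked inv
      ; majority = majority-↭ K pool↭ (majority inv)
      ; sound    = sound-↭ e (sound inv)
      }
      where
      pool↭ : r ∷ (t ∷ cs) ++ y ∷ p ↭ r ∷ (y ∷ t ∷ cs) ++ p
      pool↭ = ↭-prep r (shift y (t ∷ cs) p)
      sound-↭ : ∀ e → Sound K e (r ∷ (t ∷ cs) ++ y ∷ p) → Sound K e (r ∷ (y ∷ t ∷ cs) ++ p)
      sound-↭ noneDiscarded  covered = ∈-resp-↭ pool↭ ∘ covered
      sound-↭ (spyAmong _ _) spy     = spy

    invariant-discard : ∀ {e t cs y p} → Invariant K r e (t ∷ cs) (y ∷ p) → Spy K t ⊎ Spy K y →
      Invariant K r (spyAmong t y) cs p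
    invariant-discard {t = t} {cs} {y} {p} inv spy = record
      { linked   = Linked.tail (linked inv)
      ; majority = majority-dropPair K {xs = r ∷ cs ++ p} spy (majority-↭ K pool↭ (majority inv))
      ; sound    = spy
      }
      where
      pool↭ : r ∷ (t ∷ cs) ++ y ∷ p ↭ t ∷ y ∷ r ∷ cs ++ p
      pool↭ = ↭-trans (↭-prep r (↭-prep t (shift y cs p)))
                      (↭-sym (shift r (t ∷ y ∷ []) (cs ++ p)))

clearReserve-succeeds : ∀ {n} (K : Subset n) b {t r} → (T b → ∃ λ z → z ∉ K) →
  Knight K t → (Knight K r → ∀ i → i ∈ K) → Succeeds K (reserveCost b) (clearReserve b t r)
clearReserve-succeeds K true {r = r} promise _ onlyReserve with isKnight K r in kr
... | true  = ⊥-elim (proj₂ (promise _) (onlyReserve refl _))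
... | false = spy⇒∉ kr
clearReserve-succeeds K false {t} {r} _ kt onlyReserve = ask?-succeeds K t r _
  (λ t⇒spy    → declareSpy-succeeds K 0 (spy⇒∉ (t⇒spy kt)))
  (λ t⇒knight → declareAllKnights-succeeds K 0 (onlyReserve (t⇒knight kt)))

module _ {n} (K : Subset n) (b : Bool) (promise : T b → ∃ λ z → z ∉ K) {r : Fin n} where

  finish-succeeds : ∀ e ch → Invariant K r e ch [] → Succeeds K (finishCost b) (finish b r e ch)
  finish-succeeds (spyAmong x y) ch inv = ask?-succeeds K (judge r ch) x _
    (λ judge⇒spy    → declareSpy-succeeds K (reserveCost b) (spy⇒∉ (judge⇒spy kj)))
    (λ judge⇒knight →
      declareSpy-succeeds K (reserveCost b) (spy⇒∉ (otherSpy K (sound inv) (judge⇒knight kj))))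
    where
    kj = judge-knight K inv
  finish-succeeds noneDiscarded [] inv =
    declareAllKnights-succeeds K (finishCost b) (covered-allKnights K (sound inv) (judge-knight K inv ∷ []))
  finish-succeeds noneDiscarded (t ∷ cs) inv = ask?-succeeds K t (bottom t cs) _
    (λ t⇒spy    → declareSpy-succeeds K (reserveCost b) (spy⇒∉ (t⇒spy kt)))
    (λ t⇒knight → clearReserve-succeeds K b promise kt λ kr →
      covered-allKnights K (sound inv) (kr ∷ chainKnights (t⇒knight kt)))
    where
    kt = judge-knight K inv
    chainKnights : Knight K (bottom t cs) → All (Knight K) ((t ∷ cs) ++ [])
    chainKnights kb =
      subst (All (Knight K)) (sym (++-identityʳ (t ∷ cs))) (linked-bottomKnight K (linked inv) kb)

  sweep-succeeds : ∀ {e} ch p → Invariant K r e ch p →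
    Succeeds K (length p + finishCost b) (sweep b r e ch p)
  sweep-succeeds ch       []      inv = finish-succeeds _ ch inv
  sweep-succeeds {e} []   (y ∷ p) inv = succeeds-suc K (sweep b r e (y ∷ []) p)
    (sweep-succeeds (y ∷ []) p record { linked = [-] ; majority = majority inv ; sound = sound inv })
  sweep-succeeds (t ∷ cs) (y ∷ p) inv = ask?-succeeds K t y _
    (λ t⇒spy    → sweep-succeeds cs p (invariant-discard K inv (oneSpy K t⇒spy)))
    (λ t⇒knight → sweep-succeeds (y ∷ t ∷ cs) p (invariant-push K inv t⇒knight))

chainProtocol-succeeds : ∀ {m k} b (K : Subset (suc (suc m))) →
  suc (suc m) < 2 * k → k ≤ ∣ K ∣ → (T b → ∃ λ z → z ∉ K) →
  Succeeds K (finishCost b + m) (chainProtocol b m)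
chainProtocol-succeeds {m} b K n<2k k≤∣K∣ promise =
  subst (λ q → Succeeds K q (chainProtocol b m)) budget (sweep-succeeds K b promise _ _ start)
  where
  budget : length (tabulate {n = m} λ i → suc (suc i)) + finishCost b ≡ finishCost b + m
  budget = trans (cong (_+ finishCost b) (length-tabulate _)) (+-comm m (finishCost b))
  start : Invariant K zero noneDiscarded (suc zero ∷ []) (tabulate λ i → suc (suc i))
  start = record { linked = [-] ; majority = majority-allFin K n<2k k≤∣K∣ ; sound = ∈-allFin }

theorem2 : (n k : ℕ) → n < 2 * k → k < n →
    TtildeS n k (n ∸ 1) × TbarS n k n
theorem2 zero          k       _    ()
theorem2 (suc zero)    zero    ()   _
theorem2 (suc zero)    (suc k) _    (s≤s ())
theorem2 (suc (suc m)) k       n<2k (s≤s k≤n∸1) =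
  ( ( chainProtocol true m
    , λ K (k≤∣K∣ , spy) → chainProtocol-succeeds true K n<2k k≤∣K∣ λ _ → spy )
  , λ q q<n∸1 → identifySpy-lowerBound k≤n∸1 (s≤s q<n∸1) )
  , ( ( chainProtocol false m
      , λ K k≤∣K∣ → chainProtocol-succeeds false K n<2k k≤∣K∣ λ () )
    , λ q q<n → identifySpyOrClear-lowerBound k≤n∸1 q<n )
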